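{- Let $t \geq 2$ be an integer. If $J$ is a zero-sum sequence in $(\mathbb{Z}/3\mathbb{Z})^2$ of length $3(t+1)$, then $J$ contains a zero-sum subsequence of length $3t$.
   Context: A sequence in an abelian group is a finite list of elements (repetitions allowed); a subsequence is obtained by selecting any subset of the positions (not necessarily consecutive). A sequence is zero-sum if its terms sum to $0$. -}

module Defs where

open import Data.Nat using (ℕ; zero; suc; _+_)
open import Data.Nat.DivMod using (_mod_)
open import Data.Fin using (Fin; toℕ; zero)
open import Data.Product using (_×_; _,_)
open import Data.Vec using (Vec; []; _∷_)
open import Data.Fin.Subset using (Subset; inside; outside)

Z3 : Set
Z3 = Fin 3

_+₃_ : Z3 → Z3 → Z3
a +₃ b = (toℕ a + toℕ b) mod 3

G : Set
G = Z3 × Z3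

0G : G
0G = (zero , zero)

_⊕_ : G → G → G
(a , b) ⊕ (c , d) = (a +₃ c , b +₃ d)

σ : ∀ {n} → Vec G n → G
σ []       = 0G
σ (x ∷ xs) = x ⊕ σ xs

-- sum of the subsequence selected by a set of positions
σ-sub : ∀ {n} → Subset n → Vec G n → G
σ-sub []            []       = 0G
σ-sub (inside ∷ s)  (x ∷ xs) = x ⊕ σ-sub s xs
σ-sub (outside ∷ s) (x ∷ xs) = σ-sub s xs

module Submission where

-- Since σ J ≡ 0, it suffices to find a
-- zero-sum subsequence T of J of length 3: its complement then has length
-- 3(t+1) − 3 = 3t and sum σ J − σ T = 0.  Such a T exists in every sequence
-- of length at least 9 (and t ≥ 2 gives 3(t+1) ≥ 9).  To see this, count the
-- multiplicity of each of the 9 elements of G in the sequence.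
--   * If some element occurs at least 3 times, take three copies: 3x = 0.
--   * Otherwise every multiplicity is at most 2, so at least 5 distinct
--     elements occur.  Viewing G as the affine plane over 𝔽₃, any 5 points
--     contain a line {a, b, c}, and a + b + c = 0 for every line.
-- The "5 points contain a line" fact (the maximal cap in AG(2,3) has size 4)
-- is verified by exhaustive search over the 2⁹ subsets of G.

open import Defs
open import Data.Nat using (ℕ; zero; suc; _+_; _*_; _∸_; _≤_; z≤n; s≤s; _≤?_)
open import Data.Nat.Properties
  using ( ≤-trans; ≤-pred; ≰⇒>; n≮n; +-mono-≤; +-suc; +-comm; +-assoc; +-identityʳ
        ; *-monoʳ-≤; *-distribˡ-+; m+n∸n≡m; +-commutativeSemigroup)
open import Algebra.Properties.CommutativeSemigroup +-commutativeSemigroup using (x∙yz≈y∙xz)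
open import Data.Fin using (Fin; zero; suc; #_; _≟_; combine; remQuot)
open import Data.Fin.Properties using (all?; remQuot-combine)
open import Data.Fin.Subset using (Subset; ∣_∣; ∁; inside; outside; _⊆_; ⁅_⁆; _∪_)
open import Data.Fin.Subset.Properties using (∣∁p∣≡n∸∣p∣; _⊆?_; anySubset?; drop-∷-⊆)
open import Data.Vec using (Vec; []; _∷_; lookup; replicate; sum; updateAt; here)
open import Data.Vec.Relation.Unary.All using (All; []; _∷_)
open import Data.Vec.Relation.Binary.Pointwise.Inductive using (Pointwise; []; _∷_)
open import Data.List using (List; []; _∷_)
import Data.List.Relation.Unary.All as ListAll
open ListAll using ([]; _∷_)
open import Data.List.Relation.Unary.Any as Any using (Any; any?)
open import Data.Product using (Σ; ∃; _×_; _,_)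
open import Data.Sum using (_⊎_; inj₁; inj₂)
open import Function using (_∘_)
open import Relation.Nullary using (¬_; Dec; yes; no; contradiction)
open import Relation.Nullary.Decidable using (toWitness; toWitnessFalse; _→-dec_; ¬?; decidable-stable)
open import Relation.Binary.PropositionalEquality using (_≡_; refl; sym; trans; cong; cong₂; subst; module ≡-Reasoning)

+₃-assoc : ∀ a b c → (a +₃ b) +₃ c ≡ a +₃ (b +₃ c)
+₃-assoc = toWitness {a? = all? λ a → all? λ b → all? λ c → (a +₃ b) +₃ c ≟ a +₃ (b +₃ c)} _

+₃-comm : ∀ a b → a +₃ b ≡ b +₃ a
+₃-comm = toWitness {a? = all? λ a → all? λ b → a +₃ b ≟ b +₃ a} _

+₃-identityˡ : ∀ a → zero +₃ a ≡ a
+₃-identityˡ = toWitness {a? = all? λ a → zero +₃ a ≟ a} _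

+₃-identityʳ : ∀ a → a +₃ zero ≡ a
+₃-identityʳ = toWitness {a? = all? λ a → a +₃ zero ≟ a} _

+₃-triple : ∀ a → a +₃ (a +₃ (a +₃ zero)) ≡ zero
+₃-triple = toWitness {a? = all? λ a → a +₃ (a +₃ (a +₃ zero)) ≟ zero} _

⊕-assoc : ∀ x y z → (x ⊕ y) ⊕ z ≡ x ⊕ (y ⊕ z)
⊕-assoc (a , b) (c , d) (e , f) = cong₂ _,_ (+₃-assoc a c e) (+₃-assoc b d f)

⊕-comm : ∀ x y → x ⊕ y ≡ y ⊕ x
⊕-comm (a , b) (c , d) = cong₂ _,_ (+₃-comm a c) (+₃-comm b d)

⊕-identityˡ : ∀ x → 0G ⊕ x ≡ x
⊕-identityˡ (a , b) = cong₂ _,_ (+₃-identityˡ a) (+₃-identityˡ b)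

⊕-identityʳ : ∀ x → x ⊕ 0G ≡ x
⊕-identityʳ (a , b) = cong₂ _,_ (+₃-identityʳ a) (+₃-identityʳ b)

⊕-exchange : ∀ x y z → x ⊕ (y ⊕ z) ≡ y ⊕ (x ⊕ z)
⊕-exchange x y z = begin
  x ⊕ (y ⊕ z)  ≡⟨ sym (⊕-assoc x y z) ⟩
  (x ⊕ y) ⊕ z  ≡⟨ cong (_⊕ z) (⊕-comm x y) ⟩
  (y ⊕ x) ⊕ z  ≡⟨ ⊕-assoc y x z ⟩
  y ⊕ (x ⊕ z)  ∎
  where open ≡-Reasoning

_·_ : ℕ → G → G
zero  · x = 0G
suc k · x = x ⊕ (k · x)

·-+ : ∀ j k x → (j + k) · x ≡ (j · x) ⊕ (k · x)
·-+ zero    k x = sym (⊕-identityˡ (k · x))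
·-+ (suc j) k x = trans (cong (x ⊕_) (·-+ j k x)) (sym (⊕-assoc x (j · x) (k · x)))

3·x≡0 : ∀ x → 3 · x ≡ 0G
3·x≡0 (a , b) = cong₂ _,_ (+₃-triple a) (+₃-triple b)

σ-split : ∀ {n} (S : Subset n) (xs : Vec G n) → σ xs ≡ σ-sub S xs ⊕ σ-sub (∁ S) xs
σ-split []            []       = refl
σ-split (inside ∷ S)  (x ∷ xs) =
  trans (cong (x ⊕_) (σ-split S xs)) (sym (⊕-assoc x (σ-sub S xs) (σ-sub (∁ S) xs)))
σ-split (outside ∷ S) (x ∷ xs) =
  trans (cong (x ⊕_) (σ-split S xs)) (⊕-exchange x (σ-sub S xs) (σ-sub (∁ S) xs))

∁-zero-sum : ∀ {n} (S : Subset n) (xs : Vec G n) →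
  σ xs ≡ 0G → σ-sub S xs ≡ 0G → σ-sub (∁ S) xs ≡ 0G
∁-zero-sum S xs σxs≡0 σS≡0 = begin
  σ-sub (∁ S) xs               ≡⟨ sym (⊕-identityˡ _) ⟩
  0G ⊕ σ-sub (∁ S) xs          ≡⟨ cong (_⊕ σ-sub (∁ S) xs) (sym σS≡0) ⟩
  σ-sub S xs ⊕ σ-sub (∁ S) xs  ≡⟨ sym (σ-split S xs) ⟩
  σ xs                         ≡⟨ σxs≡0 ⟩
  0G                           ∎
  where open ≡-Reasoning

-- The 9 elements of G are numbered by Fin 9: (a , b) ↦ 3a + b.

code : G → Fin 9
code (a , b) = combine a b

decode : Fin 9 → G
decode = remQuot {3} 3

decode-code : ∀ x → decode (code x) ≡ x
decode-code (a , b) = remQuot-combine a b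

-- Multisets over Fin m, represented by their vectors of multiplicities.

Multiset : ℕ → Set
Multiset m = Vec ℕ m

∅ : ∀ {m} → Multiset m
∅ = replicate _ 0

size : ∀ {m} → Multiset m → ℕ
size = sum

value : ∀ {m} → (Fin m → G) → Multiset m → G
value f []      = 0G
value f (k ∷ r) = (k · f zero) ⊕ value (f ∘ suc) r

_≼_ : ∀ {m} → Multiset m → Multiset m → Set
_≼_ = Pointwise _≤_

add : ∀ {m} → ℕ → Fin m → Multiset m → Multiset m
add k i r = updateAt r i (k +_)

size-add : ∀ {m} k (i : Fin m) r → size (add k i r) ≡ k + size r
size-add k zero    (j ∷ r) = +-assoc k j (size r)
size-add k (suc i) (j ∷ r) = begin
  j + size (add k i r)  ≡⟨ cong (j +_) (size-add k i r) ⟩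
  j + (k + size r)      ≡⟨ x∙yz≈y∙xz j k (size r) ⟩
  k + (j + size r)      ∎
  where open ≡-Reasoning

value-add : ∀ {m} (f : Fin m → G) k i r → value f (add k i r) ≡ (k · f i) ⊕ value f r
value-add f k zero    (j ∷ r) = begin
  ((k + j) · f zero) ⊕ value (f ∘ suc) r             ≡⟨ cong (_⊕ value (f ∘ suc) r) (·-+ k j (f zero)) ⟩
  ((k · f zero) ⊕ (j · f zero)) ⊕ value (f ∘ suc) r  ≡⟨ ⊕-assoc (k · f zero) (j · f zero) (value (f ∘ suc) r) ⟩
  (k · f zero) ⊕ ((j · f zero) ⊕ value (f ∘ suc) r)  ∎
  where open ≡-Reasoning
value-add f k (suc i) (j ∷ r) = begin
  (j · f zero) ⊕ value (f ∘ suc) (add k i r)         ≡⟨ cong ((j · f zero) ⊕_) (value-add (f ∘ suc) k i r) ⟩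
  (j · f zero) ⊕ ((k · f (suc i)) ⊕ value (f ∘ suc) r) ≡⟨ ⊕-exchange (j · f zero) (k · f (suc i)) (value (f ∘ suc) r) ⟩
  (k · f (suc i)) ⊕ ((j · f zero) ⊕ value (f ∘ suc) r) ∎
  where open ≡-Reasoning

≼-add-split : ∀ {m} (i : Fin m) (r c : Multiset m) → r ≼ add 1 i c →
  r ≼ c ⊎ ∃ λ r' → r ≡ add 1 i r' × r' ≼ c
≼-add-split zero    (zero  ∷ r) (_ ∷ c) (_       ∷ r≼c) = inj₁ (z≤n ∷ r≼c)
≼-add-split zero    (suc j ∷ r) (_ ∷ c) (s≤s j≤k ∷ r≼c) = inj₂ (j ∷ r , refl , j≤k ∷ r≼c)
≼-add-split (suc i) (j ∷ r)     (_ ∷ c) (j≤k     ∷ r≼c) with ≼-add-split i r c r≼c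
... | inj₁ r≼c′             = inj₁ (j≤k ∷ r≼c′)
... | inj₂ (r' , refl , r'≼c) = inj₂ (j ∷ r' , refl , j≤k ∷ r'≼c)

≼-∅ : ∀ {m} {r : Multiset m} → r ≼ ∅ → r ≡ ∅
≼-∅ []            = refl
≼-∅ (z≤n ∷ r≼∅) = cong (0 ∷_) (≼-∅ r≼∅)

mult : ∀ {n} → Vec G n → Multiset 9
mult []       = ∅
mult (x ∷ xs) = add 1 (code x) (mult xs)

size-mult : ∀ {n} (xs : Vec G n) → size (mult xs) ≡ n
size-mult []       = refl
size-mult (x ∷ xs) = trans (size-add 1 (code x) (mult xs)) (cong suc (size-mult xs))

realise : ∀ {n} (xs : Vec G n) (r : Multiset 9) → r ≼ mult xs →
  Σ (Subset n) λ S → (∣ S ∣ ≡ size r) × (σ-sub S xs ≡ value decode r)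
realise []       r r≼∅ rewrite ≼-∅ r≼∅ = [] , refl , refl
realise (x ∷ xs) r r≼ with ≼-add-split (code x) r (mult xs) r≼
... | inj₁ r≼′ with realise xs r r≼′
...   | S , ∣S∣≡ , σS≡ = outside ∷ S , ∣S∣≡ , σS≡
realise (x ∷ xs) r r≼ | inj₂ (r' , refl , r'≼) with realise xs r' r'≼
...   | S , ∣S∣≡ , σS≡ = inside ∷ S , size-eq , sum-eq
  where
  size-eq : suc ∣ S ∣ ≡ size (add 1 (code x) r')
  size-eq = trans (cong suc ∣S∣≡) (sym (size-add 1 (code x) r'))

  sum-eq : x ⊕ σ-sub S xs ≡ value decode (add 1 (code x) r')
  sum-eq = begin
    x ⊕ σ-sub S xs                          ≡⟨ cong (x ⊕_) σS≡ ⟩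
    x ⊕ value decode r'                     ≡⟨ cong (_⊕ value decode r') (sym (⊕-identityʳ x)) ⟩
    (1 · x) ⊕ value decode r'               ≡⟨ cong (λ y → (1 · y) ⊕ value decode r') (sym (decode-code x)) ⟩
    (1 · decode (code x)) ⊕ value decode r' ≡⟨ sym (value-add decode 1 (code x) r') ⟩
    value decode (add 1 (code x) r')        ∎
    where open ≡-Reasoning

ZeroSumTriple : Multiset 9 → Set
ZeroSumTriple r = (size r ≡ 3) × (value decode r ≡ 0G)

triple-zero-sum : ∀ i → ZeroSumTriple (add 3 i ∅)
triple-zero-sum i =
  size-add 3 i ∅ , trans (value-add decode 3 i ∅) (cong (_⊕ value decode ∅) (3·x≡0 (decode i)))

∅-≼ : ∀ {m} (c : Multiset m) → ∅ ≼ c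
∅-≼ []      = []
∅-≼ (_ ∷ c) = z≤n ∷ ∅-≼ c

add-≼ : ∀ {m} k (i : Fin m) (c : Multiset m) → k ≤ lookup c i → add k i ∅ ≼ c
add-≼ k zero    (j ∷ c) k≤j = subst (_≤ j) (sym (+-identityʳ k)) k≤j ∷ ∅-≼ c
add-≼ k (suc i) (j ∷ c) k≤c = z≤n ∷ add-≼ k i c k≤c

large-or-small : ∀ {m} (c : Multiset m) → (∃ λ i → 3 ≤ lookup c i) ⊎ All (_≤ 2) c
large-or-small []      = inj₂ []
large-or-small (k ∷ c) with 3 ≤? k | large-or-small c
... | yes 3≤k | _              = inj₁ (zero , 3≤k)
... | no  _   | inj₁ (i , 3≤) = inj₁ (suc i , 3≤)
... | no  3≰k | inj₂ small     = inj₂ (≤-pred (≰⇒> 3≰k) ∷ small)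

support : ∀ {m} → Multiset m → Subset m
support []          = []
support (zero  ∷ c) = outside ∷ support c
support (suc _ ∷ c) = inside ∷ support c

size≤2∣support∣ : ∀ {m} {c : Multiset m} → All (_≤ 2) c → size c ≤ ∣ support c ∣ + ∣ support c ∣
size≤2∣support∣ {c = []}        []         = z≤n
size≤2∣support∣ {c = zero  ∷ c} (_ ∷ small) = size≤2∣support∣ small
size≤2∣support∣ {c = suc k ∷ c} (s≤s k≤1 ∷ small) =
  subst (suc k + size c ≤_) (cong suc (sym (+-suc s s)))
        (+-mono-≤ (s≤s k≤1) (size≤2∣support∣ small))
  where s = ∣ support c ∣

five-distinct : ∀ {m} {c : Multiset m} → All (_≤ 2) c → 9 ≤ size c → 5 ≤ ∣ support c ∣
five-distinct {c = c} small 9≤ with 5 ≤? ∣ support c ∣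
... | yes 5≤ = 5≤
... | no  5≰ = contradiction (≤-trans 9≤ (≤-trans (size≤2∣support∣ small) (+-mono-≤ s≤4 s≤4))) (n≮n 8)
  where
  s≤4 : ∣ support c ∣ ≤ 4
  s≤4 = ≤-pred (≰⇒> 5≰)

indicator : ∀ {m} → Subset m → Multiset m
indicator []            = []
indicator (inside  ∷ l) = 1 ∷ indicator l
indicator (outside ∷ l) = 0 ∷ indicator l

indicator-≼ : ∀ {m} (l : Subset m) {c : Multiset m} → l ⊆ support c → indicator l ≼ c
indicator-≼ []            {[]}        _   = []
indicator-≼ (outside ∷ l) {zero  ∷ c} l⊆c = z≤n ∷ indicator-≼ l (drop-∷-⊆ l⊆c)
indicator-≼ (outside ∷ l) {suc _ ∷ c} l⊆c = z≤n ∷ indicator-≼ l (drop-∷-⊆ l⊆c)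
indicator-≼ (inside  ∷ l) {suc _ ∷ c} l⊆c = s≤s z≤n ∷ indicator-≼ l (drop-∷-⊆ l⊆c)
indicator-≼ (inside  ∷ l) {zero  ∷ c} l⊆c with l⊆c here
... | ()

-- The 12 lines of the affine plane G = 𝔽₃², as sets of codes 3a + b.
line : Fin 9 → Fin 9 → Fin 9 → Subset 9
line i j k = ⁅ i ⁆ ∪ ⁅ j ⁆ ∪ ⁅ k ⁆

lines : List (Subset 9)
lines =
  line (# 0) (# 1) (# 2) ∷ line (# 3) (# 4) (# 5) ∷ line (# 6) (# 7) (# 8) ∷
  line (# 0) (# 3) (# 6) ∷ line (# 1) (# 4) (# 7) ∷ line (# 2) (# 5) (# 8) ∷
  line (# 0) (# 4) (# 8) ∷ line (# 1) (# 5) (# 6) ∷ line (# 2) (# 3) (# 7) ∷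
  line (# 0) (# 5) (# 7) ∷ line (# 1) (# 3) (# 8) ∷ line (# 2) (# 4) (# 6) ∷ []

lines-zero-sum : ListAll.All (ZeroSumTriple ∘ indicator) lines
lines-zero-sum =
  (refl , refl) ∷ (refl , refl) ∷ (refl , refl) ∷ (refl , refl) ∷ (refl , refl) ∷ (refl , refl) ∷
  (refl , refl) ∷ (refl , refl) ∷ (refl , refl) ∷ (refl , refl) ∷ (refl , refl) ∷ (refl , refl) ∷ []

ContainsLine : Subset 9 → Set
ContainsLine s = 5 ≤ ∣ s ∣ → Any (_⊆ s) lines

five-points-contain-line : ∀ s → ContainsLine s
five-points-contain-line s = decidable-stable (containsLine? s) (λ ¬c → no-counterexample (s , ¬c))
  where
  containsLine? : ∀ s → Dec (ContainsLine s)
  containsLine? s = (5 ≤? ∣ s ∣) →-dec any? (_⊆? s) lines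

  -- exhaustive search over all 2⁹ subsets
  no-counterexample : ¬ ∃ λ s → ¬ ContainsLine s
  no-counterexample = toWitnessFalse {a? = anySubset? (¬? ∘ containsLine?)} _

zero-sum-triple-≼ : (c : Multiset 9) → 9 ≤ size c → ∃ λ r → ZeroSumTriple r × r ≼ c
zero-sum-triple-≼ c 9≤ with large-or-small c
... | inj₁ (i , 3≤) = add 3 i ∅ , triple-zero-sum i , add-≼ 3 i c 3≤
... | inj₂ small    =
  let some-line = five-points-contain-line (support c) (five-distinct small 9≤)
      l = Any.lookup some-line
      (zero-sum , l⊆c) = ListAll.lookupAny lines-zero-sum some-line
  in  indicator l , zero-sum , indicator-≼ l l⊆c

zero-sum-subsequence-of-length-3 : ∀ {n} → 9 ≤ n → (xs : Vec G n) →
  Σ (Subset n) λ S → (∣ S ∣ ≡ 3) × (σ-sub S xs ≡ 0G)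
zero-sum-subsequence-of-length-3 9≤n xs
  with zero-sum-triple-≼ (mult xs) (subst (9 ≤_) (sym (size-mult xs)) 9≤n)
... | r , (size≡3 , value≡0) , r≼ with realise xs r r≼
...   | S , ∣S∣≡ , σS≡ = S , trans ∣S∣≡ size≡3 , trans σS≡ value≡0

9≤3[t+1] : ∀ t → 2 ≤ t → 9 ≤ 3 * (t + 1)
9≤3[t+1] t 2≤t = subst (λ k → 9 ≤ 3 * k) (+-comm 1 t) (*-monoʳ-≤ 3 (s≤s 2≤t))

∣∁T∣≡3t : ∀ t (T : Subset (3 * (t + 1))) → ∣ T ∣ ≡ 3 → ∣ ∁ T ∣ ≡ 3 * t
∣∁T∣≡3t t T ∣T∣≡3 = begin
  ∣ ∁ T ∣              ≡⟨ ∣∁p∣≡n∸∣p∣ T ⟩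
  3 * (t + 1) ∸ ∣ T ∣  ≡⟨ cong (3 * (t + 1) ∸_) ∣T∣≡3 ⟩
  3 * (t + 1) ∸ 3      ≡⟨ cong (_∸ 3) (*-distribˡ-+ 3 t 1) ⟩
  3 * t + 3 ∸ 3        ≡⟨ m+n∸n≡m (3 * t) 3 ⟩
  3 * t                ∎
  where open ≡-Reasoning

proposition2p3 : (t : ℕ) → 2 ≤ t → (J : Vec G (3 * (t + 1))) → σ J ≡ 0G →
    Σ (Subset (3 * (t + 1))) (λ S → (∣ S ∣ ≡ 3 * t) × (σ-sub S J ≡ 0G))
proposition2p3 t 2≤t J σJ≡0 =
  let (T , ∣T∣≡3 , σT≡0) = zero-sum-subsequence-of-length-3 (9≤3[t+1] t 2≤t) J
  in  ∁ T , ∣∁T∣≡3t t T ∣T∣≡3 , ∁-zero-sum T J σJ≡0 σT≡0
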